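{- The following inclusions hold: 1. $(T^{(0)}[F])^{\downarrow}\subseteq S^{(0)}[F^{\uparrow}]$ for every $F\in \mathfrak{F}_{\mathbb{F}^+}$; 2. $T^{(0)}[(S^{(1)}[s])^\downarrow]\subseteq s^\uparrow$ for every $s\in W^\mathcal{U}$.
   Context: $\mathbb{F}=(W,U,N,\{R_f\},\{R_g\})$ is an $\mathcal{L}$-frame; $\mathbb{F}^+$ its complex algebra of concepts $c=([\![c]\!],(\![c]\!))$ (extension $[\![c]\!]\subseteq W$, intension $(\![c]\!)\subseteq U$, $(\![c]\!)=[\![c]\!]^\uparrow$, $[\![c]\!]=(\![c]\!)^\downarrow$). $\mathfrak{F}_{\mathbb{F}^+}$, $\mathfrak{I}_{\mathbb{F}^+}$ are the filters and ideals of $\mathbb{F}^+$, related by $FN^\star I$ iff $F\cap I\ne\varnothing$; for a filter $F$, $F^\uparrow=\{I\mid F\cap I\neq\varnothing\}$ and for a set of ideals $\mathcal{Y}$, $\mathcal{Y}^\downarrow=\{F\mid\forall I\in\mathcal{Y}\,F\cap I\neq\varnothing\}$. $\mathcal{U}$ is an ultrafilter on a set $J$ with $\mathbb{F}^J/\mathcal{U}$ $|\mathcal{L}_\mathbb{F}|^+$-saturated; $W^\mathcal{U}$, $U^\mathcal{U}$ are its domains, $sN^\mathcal{U}t$ iff $\{j\mid s(j)Nt(j)\}\in\mathcal{U}$; for $X\subseteq U^\mathcal{U}$, $X^\downarrow=\{s\mid\forall t\in X\,sN^\mathcal{U}t\}$, and $s^\uparrow=\{t\mid sN^\mathcal{U}t\}$.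 $S\subseteq W^\mathcal{U}\times\mathfrak{I}_{\mathbb{F}^+}$ and $T\subseteq U^\mathcal{U}\times\mathfrak{F}_{\mathbb{F}^+}$: $sSI$ iff $s^{ -1}[[\![c]\!]]\in\mathcal{U}$ for some $c\in I$; $tTF$ iff $t^{ -1}[(\![c]\!)]\in\mathcal{U}$ for some $c\in F$. For sets: $S^{(0)}[\mathcal{Y}]=\{s\mid\forall I\in\mathcal{Y}\,sSI\}$, $S^{(1)}[s]=\{I\mid sSI\}$, $T^{(0)}[\mathcal{X}]=\{t\mid\forall F\in\mathcal{X}\,tTF\}$, and $T^{(0)}[F]=\{t\mid tTF\}$. -}

module Defs where

open import Level using (Level; _⊔_) renaming (suc to lsuc; zero to 0ℓ)
open import Data.Product using (Σ; ∃; ∃-syntax; _×_; _,_)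
open import Data.Sum using (_⊎_)
open import Data.Empty using (⊥)
open import Data.Unit using (⊤)
open import Relation.Nullary using (¬_)

Pred : Set → Set₁
Pred A = A → Set

_⊆_ : {A : Set} → Pred A → Pred A → Set
P ⊆ Q = ∀ x → P x → Q x

_⇔_ : Set → Set → Set
P ⇔ Q = (P → Q) × (Q → P)

record IsUltrafilter (J : Set) (𝒰 : Pred J → Set) : Set₁ where
  field
    whole     : 𝒰 (λ _ → ⊤)
    noEmpty   : ¬ 𝒰 (λ _ → ⊥)
    upward    : ∀ {A B} → A ⊆ B → 𝒰 A → 𝒰 B
    meet      : ∀ {A B} → 𝒰 A → 𝒰 B → 𝒰 (λ j → A j × B j)
    ultra     : ∀ A → 𝒰 A ⊎ 𝒰 (λ j → ¬ A j)

module Polarity (W U : Set) (N : W → U → Set) where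

  _↑ : Pred W → Pred U
  (X ↑) u = ∀ w → X w → N w u

  _↓ : Pred U → Pred W
  (Y ↓) w = ∀ u → Y u → N w u

  record Concept : Set₁ where
    field
      ext : Pred W
      int : Pred U
      int-closed : ∀ u → int u ⇔ (ext ↑) u
      ext-closed : ∀ w → ext w ⇔ (int ↓) w
  open Concept public

  _≤_ : Concept → Concept → Set
  c ≤ d = ext c ⊆ ext d

  IsMeet : Concept → Concept → Concept → Set
  IsMeet c d e = ∀ w → ext e w ⇔ (ext c w × ext d w)

  IsJoin : Concept → Concept → Concept → Set
  IsJoin c d e = ∀ u → int e u ⇔ (int c u × int d u)

  -- lattice filters of the complex algebra F⁺ (sets of concepts)
  record IsFilter (F : Concept → Set) : Set₁ where
    field
      nonempty : ∃[ c ] F c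
      upward   : ∀ {c d} → c ≤ d → F c → F d
      meetCl   : ∀ {c d e} → F c → F d → IsMeet c d e → F e

  record IsIdeal (I : Concept → Set) : Set₁ where
    field
      nonempty : ∃[ c ] I c
      downward : ∀ {c d} → c ≤ d → I d → I c
      joinCl   : ∀ {c d e} → I c → I d → IsJoin c d e → I e

  _N⋆_ : (Concept → Set) → (Concept → Set) → Set₁
  F N⋆ I = ∃[ c ] (F c × I c)

  -- Elements of W^𝒰, U^𝒰 are represented by functions J → W, J → U;
  -- all relations below are invariant under 𝒰-almost-everywhere equality.

  module Ultra (J : Set) (𝒰 : Pred J → Set) where

    W𝒰 U𝒰 : Set
    W𝒰 = J → W
    U𝒰 = J → U

    _N𝒰_ : W𝒰 → U𝒰 → Set
    s N𝒰 t = 𝒰 (λ j → N (s j) (t j))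

    _↑𝒰 : W𝒰 → Pred U𝒰
    (s ↑𝒰) t = s N𝒰 t

    _↓𝒰 : (U𝒰 → Set₁) → W𝒰 → Set₁
    (X ↓𝒰) s = ∀ t → X t → s N𝒰 t

    _S_ : W𝒰 → (Concept → Set) → Set₁
    s S I = ∃[ c ] (I c × 𝒰 (λ j → ext c (s j)))

    _T_ : U𝒰 → (Concept → Set) → Set₁
    t T F = ∃[ c ] (F c × 𝒰 (λ j → int c (t j)))

    _↑F : (Concept → Set) → (Concept → Set) → Set₁
    (F ↑F) I = IsIdeal I × (F N⋆ I)

    _↓I : ((Concept → Set) → Set₁) → (Concept → Set) → Set₁
    (𝒴 ↓I) F = IsFilter F × (∀ I → 𝒴 I → F N⋆ I)

    S⁰ : ((Concept → Set) → Set₁) → W𝒰 → Set₁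
    S⁰ 𝒴 s = ∀ I → 𝒴 I → s S I

    S¹ : W𝒰 → (Concept → Set) → Set₁
    S¹ s I = IsIdeal I × (s S I)

    T⁰ : ((Concept → Set) → Set₁) → U𝒰 → Set₁
    T⁰ 𝒳 t = ∀ F → 𝒳 F → t T F

    T⁰₁ : (Concept → Set) → U𝒰 → Set₁
    T⁰₁ F t = t T F

module Submission where

open import Defs
open import Level using (Level; 0ℓ)
open import Data.Product using (_×_; _,_; proj₁; proj₂; ∃-syntax)
open import Data.Sum using (inj₁; inj₂)
open import Data.Empty using (⊥; ⊥-elim)
open import Data.Unit using (⊤; tt)
open import Relation.Nullary using (¬_; yes; no)
open import Relation.Nullary.Decidable using (decidable-stable)
open import Axiom.ExcludedMiddle using (ExcludedMiddle)

-- Part 1: if s is N^𝒰-related to every t lying 𝒰-almost everywhere in ((c)),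
-- then s lies 𝒰-almost everywhere in [[c]] = ((c))^↓: otherwise, on the 𝒰-large
-- set where s(j) ∉ [[c]], pick t(j) ∈ ((c)) with ¬ s(j) N t(j), and t contradicts
-- the hypothesis. Taking c ∈ F ∩ I then gives s S I.
-- Part 2: the concepts containing s 𝒰-almost everywhere form a filter meeting
-- every ideal in S^(1)[s], and any concept shared with t witnesses s N^𝒰 t.

module _ {W U : Set} {N : W → U → Set} where
  open Polarity W U N

  ext-int⇒N : (c : Concept) {w : W} {u : U} → ext c w → int c u → N w u
  ext-int⇒N c {w} {u} w∈ u∈ = proj₁ (ext-closed c w) w∈ u u∈

  ⊤-concept : Concept
  ⊤-concept = record
    { ext        = λ _ → ⊤
    ; int        = λ u → ∀ w → N w u
    ; int-closed = λ u → (λ n w _ → n w) , (λ n w → n w tt)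
    ; ext-closed = λ w → (λ _ u n → n w) , (λ _ → tt)
    }

  module _ (lem : ExcludedMiddle 0ℓ) where

    ∉ext⇒∃int : (c : Concept) {w : W} → ¬ ext c w → ∃[ u ] (int c u × ¬ N w u)
    ∉ext⇒∃int c {w} w∉ with lem {P = ∃[ u ] (int c u × ¬ N w u)}
    ... | yes witness = witness
    ... | no  none    = ⊥-elim (w∉ (proj₂ (ext-closed c w) w∈int↓))
      where
      w∈int↓ : ∀ u → int c u → N w u
      w∈int↓ u u∈ = decidable-stable lem λ ¬n → none (u , u∈ , ¬n)

    int-separates : (c : Concept) {u₀ : U} → int c u₀
                  → ∀ w → ∃[ u ] (int c u × (¬ ext c w → ¬ N w u))
    int-separates c {u₀} u₀∈ w with lem {P = ext c w}
    ... | yes w∈ = u₀ , u₀∈ , λ w∉ → ⊥-elim (w∉ w∈)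
    ... | no  w∉ = let (u , u∈ , ¬n) = ∉ext⇒∃int c w∉ in u , u∈ , λ _ → ¬n

  module _ {J : Set} {𝒰 : Pred J → Set} (UF : IsUltrafilter J 𝒰) where
    open Ultra J 𝒰
    open IsUltrafilter UF

    ∈𝒰⇒¬¬inhabited : {A : Pred J} → 𝒰 A → ¬ ¬ (∃[ j ] A j)
    ∈𝒰⇒¬¬inhabited 𝒰A uninhabited = noEmpty (upward (λ j a → uninhabited (j , a)) 𝒰A)

    ext𝒰-closed : ExcludedMiddle 0ℓ → (c : Concept) (s : W𝒰)
                → (∀ t → 𝒰 (λ j → int c (t j)) → s N𝒰 t)
                → 𝒰 (λ j → ext c (s j))
    ext𝒰-closed lem c s s∈int↓ with ultra (λ j → ext c (s j))
    ... | inj₁ 𝒰ext = 𝒰ext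
    -- t(j) needs a default in ((c)) where s(j) ∈ [[c]]; a coordinate with s(j) ∉ [[c]] supplies one.
    ... | inj₂ 𝒰∉ext = ⊥-elim (∈𝒰⇒¬¬inhabited 𝒰∉ext λ (_ , s∉) →
                         let (_ , u₀∈ , _) = ∉ext⇒∃int lem c s∉ in refute u₀∈)
      where
      refute : ∀ {u₀} → int c u₀ → ⊥
      refute u₀∈ = noEmpty (upward separated (meet 𝒰∉ext (s∈int↓ t 𝒰t∈int)))
        where
        separation : ∀ j → ∃[ u ] (int c u × (¬ ext c (s j) → ¬ N (s j) u))
        separation j = int-separates lem c u₀∈ (s j)
        t : U𝒰
        t j = proj₁ (separation j)
        𝒰t∈int : 𝒰 (λ j → int c (t j))
        𝒰t∈int = upward (λ j _ → proj₁ (proj₂ (separation j))) whole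
        separated : ∀ j → ¬ ext c (s j) × N (s j) (t j) → ⊥
        separated j (s∉ , n) = proj₂ (proj₂ (separation j)) s∉ n

    T⁰₁↓⊆S⁰↑F : ExcludedMiddle 0ℓ → (F : Concept → Set) → ∀ s → (T⁰₁ F ↓𝒰) s → S⁰ (F ↑F) s
    T⁰₁↓⊆S⁰↑F lem F s s∈T⁰↓ I (_ , c , c∈F , c∈I) =
      c , c∈I , ext𝒰-closed lem c s λ t 𝒰int → s∈T⁰↓ t (c , c∈F , 𝒰int)

    filterAt : W𝒰 → Concept → Set
    filterAt s c = 𝒰 (λ j → ext c (s j))

    filterAt-isFilter : ∀ s → IsFilter (filterAt s)
    filterAt-isFilter s = record
      { nonempty = ⊤-concept , whole
      ; upward   = λ c≤d 𝒰c → upward (λ j → c≤d (s j)) 𝒰c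
      ; meetCl   = λ 𝒰c 𝒰d e≡c∧d → upward (λ j → proj₂ (e≡c∧d (s j))) (meet 𝒰c 𝒰d)
      }

    T⁰S¹↓⊆↑𝒰 : (s : W𝒰) → ∀ t → T⁰ (S¹ s ↓I) t → (s ↑𝒰) t
    T⁰S¹↓⊆↑𝒰 s t t∈T⁰ =
      let (c , 𝒰ext , 𝒰int) = t∈T⁰ (filterAt s) (filterAt-isFilter s , meetsS¹)
      in upward (λ j (s∈ , t∈) → ext-int⇒N c s∈ t∈) (meet 𝒰ext 𝒰int)
      where
      meetsS¹ : ∀ I → S¹ s I → filterAt s N⋆ I
      meetsS¹ I (_ , c , c∈I , 𝒰ext) = c , 𝒰ext , c∈I

mainTheorem16 : (lem : ∀ {ℓ : Level} → ExcludedMiddle ℓ)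
    (W U : Set) (N : W → U → Set) (J : Set) (𝒰 : Pred J → Set)
    → IsUltrafilter J 𝒰
    → let open Polarity W U N in
    let open Ultra J 𝒰 in
    ((F : Concept → Set) → IsFilter F
    → ∀ s → (T⁰₁ F ↓𝒰) s → S⁰ (F ↑F) s)
    × ((s : W𝒰) → ∀ t → T⁰ (S¹ s ↓I) t → (s ↑𝒰) t)
mainTheorem16 lem W U N J 𝒰 UF =
  (λ F _ → T⁰₁↓⊆S⁰↑F UF lem F) , T⁰S¹↓⊆↑𝒰 UF
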